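{- Let $k\ge 1$ and let $D$ be an orientation of the star $K_{1,k}$ with central vertex $v$. Then $2\le \chi_d(D)\le 3$; moreover $\chi_d(D)=2$ if and only if all arcs are oriented similarly with respect to $v$ (i.e., either all arcs are directed away from $v$ or all arcs are directed toward $v$), and $\chi_d(D)=3$ otherwise.
   Context: For a digraph $D$ and $u\in V(D)$, $N^+(u)=\{w: uw\in A(D)\}$. A dominator coloring of $D$ is a partition of $V(D)$ into color classes such that (i) it is a proper coloring of the underlying graph (adjacent vertices receive different colors), and (ii) every vertex $u$ with at least one out-neighbor dominates some color class, i.e., there is a color class $C$ with $C\subseteq N^+(u)$; vertices of out-degree $0$ are not required to dominate anything. $\chi_d(D)$ is the minimum number of color classes in a dominator coloring of $D$. -}

module Defs where

open import Data.Nat using (ℕ; zero; suc; _<_)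
open import Data.Fin using (Fin; zero; suc)
open import Data.Bool using (Bool; true; false)
open import Data.Empty using (⊥)
open import Data.Unit using (⊤)
open import Data.Product using (Σ; ∃; _×_)
open import Relation.Binary.PropositionalEquality using (_≡_; _≢_)
open import Function.Definitions using (Surjective)

record Digraph : Set₁ where
  field
    vertices : ℕ
    Arc      : Fin vertices → Fin vertices → Set

open Digraph public

-- A coloring with exactly m (nonempty) color classes: a surjection V(D) → Fin m.
-- Color class j is { x | c x ≡ j }.
IsDominatorColoring : (D : Digraph) (m : ℕ) → (Fin (vertices D) → Fin m) → Set
IsDominatorColoring D m c =
  Surjective _≡_ _≡_ c
  × (∀ u w → Arc D u w → c u ≢ c w)
  × (∀ u → (∃ λ w → Arc D u w) → ∃ λ (j : Fin m) → ∀ x → c x ≡ j → Arc D u x)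

HasDominatorColoring : Digraph → ℕ → Set
HasDominatorColoring D m = ∃ λ (c : Fin (vertices D) → Fin m) → IsDominatorColoring D m c

ChiD≡ : Digraph → ℕ → Set
ChiD≡ D m = HasDominatorColoring D m × (∀ m′ → m′ < m → HasDominatorColoring D m′ → ⊥)

-- Orientation of the star K_{1,k}: center is vertex zero, leaves are suc i (i : Fin k).
-- o i = true  : arc from the center to leaf i  (directed away from v)
-- o i = false : arc from leaf i to the center  (directed toward v)
StarArc : {k : ℕ} → (Fin k → Bool) → Fin (suc k) → Fin (suc k) → Set
StarArc o zero    zero    = ⊥
StarArc o zero    (suc i) = o i ≡ true
StarArc o (suc i) zero    = o i ≡ false
StarArc o (suc i) (suc j) = ⊥

Star : (k : ℕ) → (Fin k → Bool) → Digraph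
Star k o = record { vertices = suc k ; Arc = StarArc o }

-- A dominator coloring needs two colors as soon as there is an arc. With only two colors,
-- the class dominated by a loop-free vertex u is not u's own class, so it contains every
-- neighbour of u: u must then be an in-neighbour of each of its neighbours. At the center
-- of a star this forces all arcs to point outward once one of them does, so a mixed
-- orientation needs a third color; coloring the leaves by the direction of their arc
-- shows that three always suffice.
module Submission where

open import Defs
open import Data.Nat using (ℕ; _≤_; _<_; s≤s; suc)
open import Data.Nat.Properties using (≤-refl; n≤1+n; m<1+n⇒m<n∨m≡n)
open import Data.Fin using (Fin; zero; suc; fromℕ<)
open import Data.Fin.Properties using (¬Fin0; all?; ¬∀⟶∃¬)
open import Data.Bool using (Bool; true; false)
open import Data.Bool.Properties using (¬-not) renaming (_≟_ to _≟ᵇ_)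
open import Data.Product using (Σ; ∃; ∃₂; _×_; _,_)
open import Data.Sum using (_⊎_; inj₁; inj₂)
open import Relation.Nullary using (¬_; Dec; yes; no; contradiction)
open import Relation.Nullary.Decidable using (_⊎-dec_)
open import Relation.Binary.PropositionalEquality using (_≡_; _≢_; refl; sym; trans)
open import Function.Bundles using (_⇔_; mk⇔)

Fin1-≡ : (a b : Fin 1) → a ≡ b
Fin1-≡ zero zero = refl

Fin2-third : (a b x : Fin 2) → a ≢ b → a ≢ x → x ≡ b
Fin2-third zero       zero       _          a≢b _   = contradiction refl a≢b
Fin2-third zero       (suc zero) zero       _   a≢x = contradiction refl a≢x
Fin2-third zero       (suc zero) (suc zero) _   _   = refl
Fin2-third (suc zero) zero       zero       _   _   = refl
Fin2-third (suc zero) zero       (suc zero) _   a≢x = contradiction refl a≢x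
Fin2-third (suc zero) (suc zero) _          a≢b _   = contradiction refl a≢b

module _ (D : Digraph) where

  ¬dominatorColoring-0 : Fin (vertices D) → ¬ HasDominatorColoring D 0
  ¬dominatorColoring-0 u (c , _) = ¬Fin0 (c u)

  ¬dominatorColoring-1 : ∀ {u w} → Arc D u w → ¬ HasDominatorColoring D 1
  ¬dominatorColoring-1 {u} {w} uw (c , _ , proper , _) = proper u w uw (Fin1-≡ (c u) (c w))

  ¬dominatorColoring-<2 : ∀ {m} → ∃₂ (Arc D) → m < 2 → ¬ HasDominatorColoring D m
  ¬dominatorColoring-<2 {0}           (u , _ , _)  _ = ¬dominatorColoring-0 u
  ¬dominatorColoring-<2 {1}           (_ , _ , uw) _ = ¬dominatorColoring-1 uw
  ¬dominatorColoring-<2 {suc (suc _)} _ (s≤s (s≤s ()))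

  dominatorColoring-2⇒reverse-arc : ∀ {u w} → ¬ Arc D u u → ∃ (Arc D u) → Arc D w u →
                                    HasDominatorColoring D 2 → Arc D u w
  dominatorColoring-2⇒reverse-arc {u} {w} ¬uu out wu (c , _ , proper , dominates)
    with dominates u out
  ... | j , class⊆N⁺u =
    class⊆N⁺u w (Fin2-third (c u) j (c w) (λ cu≡j → ¬uu (class⊆N⁺u u cu≡j))
                                          (λ cu≡cw → proper w u wu (sym cu≡cw)))

module _ {k : ℕ} (o : Fin k → Bool) where

  Uniform : Set
  Uniform = (∀ i → o i ≡ true) ⊎ (∀ i → o i ≡ false)

  uniform? : Dec Uniform
  uniform? = all? (λ i → o i ≟ᵇ true) ⊎-dec all? (λ i → o i ≟ᵇ false)

  ¬uniform⇒mixed : ¬ Uniform → (∃ λ i → o i ≡ true) × (∃ λ j → o j ≡ false)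
  ¬uniform⇒mixed ¬uniform with ¬∀⟶∃¬ k _ (λ i → o i ≟ᵇ false) (λ all-false → ¬uniform (inj₂ all-false))
                             | ¬∀⟶∃¬ k _ (λ i → o i ≟ᵇ true)  (λ all-true → ¬uniform (inj₁ all-true))
  ... | i , oi≢false | j , oj≢true = (i , ¬-not oi≢false) , (j , ¬-not oj≢true)

  star-arc : Fin k → ∃₂ (StarArc o)
  star-arc i with o i in oi
  ... | true  = zero , suc i , oi
  ... | false = suc i , zero , oi

  centerVsLeaves : Fin (suc k) → Fin 2
  centerVsLeaves zero    = zero
  centerVsLeaves (suc _) = suc zero

  uniformStar-dominatorColoring-2 : Fin k → ∀ {b} → (∀ i → o i ≡ b) → HasDominatorColoring (Star k o) 2
  uniformStar-dominatorColoring-2 leaf all-b = centerVsLeaves , surjective , proper , dominates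
    where
    surjective : ∀ j → ∃ λ x → ∀ {z} → z ≡ x → centerVsLeaves z ≡ j
    surjective zero       = zero , λ { refl → refl }
    surjective (suc zero) = suc leaf , λ { refl → refl }

    proper : ∀ u w → StarArc o u w → centerVsLeaves u ≢ centerVsLeaves w
    proper zero    (suc _) _ ()
    proper (suc _) zero    _ ()

    dominates : ∀ u → ∃ (StarArc o u) → ∃ λ j → ∀ x → centerVsLeaves x ≡ j → StarArc o u x
    dominates zero    (suc w , ow) = suc zero , λ { (suc x) _ → trans (all-b x) (trans (sym (all-b w)) ow) }
    dominates (suc u) (zero , ou)  = zero , λ { zero _ → ou }

  byOrientation : Fin (suc k) → Fin 3
  byOrientation zero    = zero
  byOrientation (suc i) with o i
  ... | true  = suc zero
  ... | false = suc (suc zero)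

  byOrientation-leaf≢center : ∀ i → byOrientation (suc i) ≢ zero
  byOrientation-leaf≢center i with o i
  ... | true  = λ ()
  ... | false = λ ()

  mixedStar-dominatorColoring-3 : ∀ {i j} → o i ≡ true → o j ≡ false → HasDominatorColoring (Star k o) 3
  mixedStar-dominatorColoring-3 {i} {j} oi oj = byOrientation , surjective , proper , dominates
    where
    surjective : ∀ c → ∃ λ x → ∀ {z} → z ≡ x → byOrientation z ≡ c
    surjective zero             = zero , λ { refl → refl }
    surjective (suc zero)       = suc i , λ { refl → outward }
      where outward : byOrientation (suc i) ≡ suc zero
            outward rewrite oi = refl
    surjective (suc (suc zero)) = suc j , λ { refl → inward }
      where inward : byOrientation (suc j) ≡ suc (suc zero)
            inward rewrite oj = refl

    proper : ∀ u w → StarArc o u w → byOrientation u ≢ byOrientation w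
    proper zero    (suc w) _ = λ 0≡cw → byOrientation-leaf≢center w (sym 0≡cw)
    proper (suc u) zero    _ = byOrientation-leaf≢center u

    outward-class : ∀ x → byOrientation x ≡ suc zero → StarArc o zero x
    outward-class (suc x) _ with o x
    outward-class (suc x) _  | true = refl
    outward-class (suc x) () | false

    dominates : ∀ u → ∃ (StarArc o u) → ∃ λ c → ∀ x → byOrientation x ≡ c → StarArc o u x
    dominates zero    _           = suc zero , outward-class
    dominates (suc u) (zero , ou) =
      zero , λ { zero _ → ou ; (suc x) cx≡0 → contradiction cx≡0 (byOrientation-leaf≢center x) }

  mixedStar-¬dominatorColoring-2 : ∀ {i j} → o i ≡ true → o j ≡ false → ¬ HasDominatorColoring (Star k o) 2
  mixedStar-¬dominatorColoring-2 {i} {j} oi oj coloring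
    with dominatorColoring-2⇒reverse-arc (Star k o) {zero} {suc j} (λ ()) (suc i , oi) oj coloring
  ... | oj≡true = contradiction (trans (sym oj) oj≡true) (λ ())

  uniformStar-χd≡2 : Fin k → Uniform → ChiD≡ (Star k o) 2
  uniformStar-χd≡2 leaf uniform = coloring uniform , λ _ → ¬dominatorColoring-<2 (Star k o) (star-arc leaf)
    where
    coloring : Uniform → HasDominatorColoring (Star k o) 2
    coloring (inj₁ all-true)  = uniformStar-dominatorColoring-2 leaf all-true
    coloring (inj₂ all-false) = uniformStar-dominatorColoring-2 leaf all-false

  mixedStar-χd≡3 : ∀ {i j} → o i ≡ true → o j ≡ false → ChiD≡ (Star k o) 3
  mixedStar-χd≡3 {i} oi oj = mixedStar-dominatorColoring-3 oi oj , below3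
    where
    below3 : ∀ m → m < 3 → ¬ HasDominatorColoring (Star k o) m
    below3 m m<3 with m<1+n⇒m<n∨m≡n m<3
    ... | inj₁ m<2  = ¬dominatorColoring-<2 (Star k o) (zero , suc i , oi) m<2
    ... | inj₂ refl = mixedStar-¬dominatorColoring-2 oi oj

proposition3 : (k : ℕ) → 1 ≤ k → (o : Fin k → Bool) →
    Σ ℕ λ m → ChiD≡ (Star k o) m × 2 ≤ m × m ≤ 3
    × (m ≡ 2 ⇔ ((∀ i → o i ≡ true) ⊎ (∀ i → o i ≡ false)))
    × (m ≡ 3 ⇔ (¬ ((∀ i → o i ≡ true) ⊎ (∀ i → o i ≡ false))))
proposition3 k 1≤k o with uniform? o
... | yes uniform =
  2 , uniformStar-χd≡2 o (fromℕ< 1≤k) uniform , ≤-refl , n≤1+n 2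
    , mk⇔ (λ _ → uniform) (λ _ → refl)
    , mk⇔ (λ ()) (λ ¬uniform → contradiction uniform ¬uniform)
... | no ¬uniform with ¬uniform⇒mixed o ¬uniform
...   | (_ , oi) , (_ , oj) =
  3 , mixedStar-χd≡3 o oi oj , n≤1+n 2 , ≤-refl
    , mk⇔ (λ ()) (λ uniform → contradiction uniform ¬uniform)
    , mk⇔ (λ _ → ¬uniform) (λ _ → refl)
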